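{- Let $a$ be an odd positive integer and $m$ a nonnegative integer. For every positive integer $n$: if $n\equiv \frac{a-1}2+m\pmod 2$ then $$t(a,3a,8m+4;n)=\frac 23N(a,3a,8m+4;8n+4a+8m+4),$$ and if $n\not\equiv \frac{a-1}2+m\pmod 2$ then $$t(a,3a,8m+4;n)=\frac 23\big(N(a,3a,8m+4;8n+4a+8m+4)-N(a,3a,8m+4;2n+a+2m+1)\big).$$
   Context: For positive integers $a_1,\dots,a_k$ and a nonnegative integer $n$, $N(a_1,\dots,a_k;n)$ is the number of $(x_1,\dots,x_k)\in\mathbb Z^k$ with $n=a_1x_1^2+\cdots+a_kx_k^2$, and $t(a_1,\dots,a_k;n)$ is the number of $(x_1,\dots,x_k)\in\mathbb Z^k$ with $n=a_1\frac{x_1(x_1-1)}2+\cdots+a_k\frac{x_k(x_k-1)}2$. -}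

module Defs where

open import Data.Nat as ℕ using (ℕ; zero; suc)
open import Data.Integer as ℤ using (ℤ; +_; -[1+_]; _-_; _*_; _+_)
open import Data.List using (List; []; _∷_; map; upTo)
open import Data.Nat.ListAction using (sum)
open import Relation.Nullary using (does)
open import Data.Bool using (if_then_else_)

range : ℕ → List ℤ
range B = map (λ i → (+ i) - (+ B)) (upTo (ℕ.suc (2 ℕ.* B)))

-- reps f B as r = number of tuples (x₁,…,x_k) with every xᵢ ∈ [-B,B]
-- and a₁ f(x₁) + ⋯ + a_k f(x_k) = r, where as = a₁ ∷ ⋯ ∷ a_k.
reps : (ℤ → ℤ) → ℕ → List ℕ → ℤ → ℕ
reps f B []       r = if does (r ℤ.≟ + 0) then 1 else 0
reps f B (a ∷ as) r = sum (map (λ x → reps f B as (r - (+ a) * f x)) (range B))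

sq : ℤ → ℤ
sq x = x * x

-- x(x-1)/2, computed exactly as the integer quotient of the even number x(x-1)
tri : ℤ → ℤ
tri x = (x * (x - + 1)) ℤ./ (+ 2)
  where open import Data.Integer.DivMod using (_/_)

-- N(a₁,…,a_k; n): number of (x₁,…,x_k) ∈ ℤ^k with n = Σ aᵢ xᵢ².
-- For positive aᵢ every solution has |xᵢ| ≤ xᵢ² ≤ n, so the box [-n,n]^k
-- contains all solutions and the count is exact.
N : List ℕ → ℕ → ℕ
N as n = reps sq n as (+ n)

-- t(a₁,…,a_k; n): number of (x₁,…,x_k) ∈ ℤ^k with n = Σ aᵢ xᵢ(xᵢ-1)/2.
-- For positive aᵢ every solution has xᵢ(xᵢ-1)/2 ≤ n, hence xᵢ ∈ [-n, n+1],
-- so the box [-(n+1), n+1]^k contains all solutions and the count is exact.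
t : List ℕ → ℕ → ℕ
t as n = reps tri (suc n) as (+ n)

-- Write a = 1 + 2α and L = n + α + m + 1, so that the two right-hand sides are
-- 8n + 4a + 8m + 4 = 8L and 2n + a + 2m + 1 = 2L, and let Q(x, y, z) = ax² + 3ay² + (8m + 4)z².
-- Every solution of Q = 8L has x ≡ y (mod 2). When x is odd, z is odd as well, and v ↦ 2v − 1
-- matches these solutions with the representations of n counted by t, because
-- (2x − 1)² = 8·x(x − 1)/2 + 1. When x and z are even, halving matches them with the solutions
-- of Q = 2L. When x is even and z is odd, they are matched with the representations counted by t
-- that have x + y odd, through (x, y) ↦ (x − 3y + 1, x + y − 1): this is the automorphism
-- (X, Y) ↦ ((X − 3Y)/2, (X + Y)/2) of X² + 3Y² applied to (2x − 1, 2y − 1). The reflection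
-- y ↦ 1 − y shows that these are half of all representations counted by t. Hence
-- N(8L) = t + t/2 + N(2L), and when L is odd Q never takes the value 2L ≡ 2 (mod 4).

module Submission where

open import Defs
open import Data.Integer using (ℤ)
import Data.Nat as ℕ
open import Relation.Binary.PropositionalEquality using (_≡_)

module FilterCounting where

  open import Data.Bool using (true; false; if_then_else_)
  open import Data.List using (List; []; _∷_; _++_; map; length; filter; cartesianProduct)
  open import Data.List.Properties using (length-map; length-++; filter-++; filter-none)
  open import Data.List.Relation.Unary.All using (universal)
  open import Data.List.Relation.Unary.Any using (here; there)
  open import Data.List.Membership.Propositional using (_∈_)
  open import Data.List.Membership.Propositional.Properties using (∈-map⁺; ∈-map⁻; ∈-filter⁺; ∈-filter⁻)
  open import Data.List.Membership.Propositional.Properties.WithK using (unique∧set⇒bag)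
  open import Data.List.Relation.Binary.BagAndSetEquality using (_∼[_]_; set; ∼bag⇒↭)
  open import Data.List.Relation.Binary.Permutation.Propositional.Properties using (↭-length)
  open import Data.List.Relation.Unary.Unique.Propositional using (Unique)
  import Data.List.Relation.Unary.Unique.Propositional.Properties as Unique
  open import Data.Nat using (suc; _+_)
  open import Data.Nat.ListAction using (sum)
  open import Data.Nat.Properties using (+-suc)
  open import Data.Product using (_×_; _,_; proj₂)
  open import Function using (_∘_)
  open import Function.Bundles using (mk⇔)
  open import Level using (0ℓ)
  open import Relation.Binary.PropositionalEquality
  open import Relation.Nullary using (¬_; does)
  open import Relation.Unary using (Pred; Decidable; _⊆_)
  open import Relation.Unary.Properties using (_∩?_; ∁?)

  private
    variable
      A B : Set
      P Q : Pred A 0ℓ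

  record Correspondence (P : Pred A 0ℓ) (Q : Pred B 0ℓ) : Set where
    field
      to      : A → B
      from    : B → A
      to-⊆    : P ⊆ Q ∘ to
      from-⊆  : Q ⊆ P ∘ from
      from∘to : ∀ {v} → P v → from (to v) ≡ v
      to∘from : ∀ {w} → Q w → to (from w) ≡ w

  map-inverse-on : (f : A → B) (g : B → A) (xs : List A) →
    (∀ {x} → x ∈ xs → g (f x) ≡ x) → map g (map f xs) ≡ xs
  map-inverse-on f g []       g∘f≡id = refl
  map-inverse-on f g (x ∷ xs) g∘f≡id =
    cong₂ _∷_ (g∘f≡id (here refl)) (map-inverse-on f g xs (g∘f≡id ∘ there))

  length-filter-correspondence :
    (P? : Decidable P) (Q? : Decidable Q) {xs : List A} {ys : List B} →
    Unique xs → Unique ys → P ⊆ (_∈ xs) → Q ⊆ (_∈ ys) → Correspondence P Q →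
    length (filter P? xs) ≡ length (filter Q? ys)
  length-filter-correspondence P? Q? {xs} {ys} xs-unique ys-unique P⊆xs Q⊆ys c =
    trans (sym (length-map to Pxs))
          (↭-length (∼bag⇒↭ (unique∧set⇒bag image-unique (Unique.filter⁺ Q? ys-unique) image≈Qys)))
    where
    open Correspondence c
    Pxs = filter P? xs

    image-unique : Unique (map to Pxs)
    image-unique = Unique.map⁻ (subst Unique (sym from∘to≡id) (Unique.filter⁺ P? xs-unique))
      where from∘to≡id = map-inverse-on to from Pxs (from∘to ∘ proj₂ ∘ ∈-filter⁻ P? {xs = xs})

    image≈Qys : map to Pxs ∼[ set ] filter Q? ys
    image≈Qys {w} = mk⇔ image⊆ ⊆image
      where
      image⊆ : w ∈ map to Pxs → w ∈ filter Q? ys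
      image⊆ w∈ with v , v∈ , refl ← ∈-map⁻ to w∈ =
        let Qw = to-⊆ (proj₂ (∈-filter⁻ P? {xs = xs} v∈)) in ∈-filter⁺ Q? (Q⊆ys Qw) Qw
      ⊆image : w ∈ filter Q? ys → w ∈ map to Pxs
      ⊆image w∈ with _ , Qw ← ∈-filter⁻ Q? {xs = ys} w∈ =
        subst (_∈ map to Pxs) (to∘from Qw) (∈-map⁺ to (∈-filter⁺ P? (P⊆xs (from-⊆ Qw)) (from-⊆ Qw)))

  length-filter-split : (P? : Decidable P) (Q? : Decidable Q) (xs : List A) →
    length (filter P? xs) ≡ length (filter (P? ∩? Q?) xs) + length (filter (P? ∩? ∁? Q?) xs)
  length-filter-split P? Q? [] = refl
  length-filter-split P? Q? (x ∷ xs) with does (P? x) | does (Q? x)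
  ... | true  | true  = cong suc (length-filter-split P? Q? xs)
  ... | true  | false = trans (cong suc (length-filter-split P? Q? xs)) (sym (+-suc _ _))
  ... | false | _     = length-filter-split P? Q? xs

  length-filter-empty : (P? : Decidable P) (xs : List A) → (∀ v → ¬ P v) → length (filter P? xs) ≡ 0
  length-filter-empty P? xs ¬P = cong length (filter-none P? (universal ¬P xs))

  sum-indicator≡length-filter : (P? : Decidable P) (xs : List A) →
    sum (map (λ x → if does (P? x) then 1 else 0) xs) ≡ length (filter P? xs)
  sum-indicator≡length-filter P? [] = refl
  sum-indicator≡length-filter P? (x ∷ xs) with does (P? x)
  ... | true  = cong suc (sum-indicator≡length-filter P? xs)
  ... | false = sum-indicator≡length-filter P? xs

  length-filter-cartesianProduct : {P : Pred (A × B) 0ℓ} (P? : Decidable P) (xs : List A) (ys : List B) →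
    length (filter P? (cartesianProduct xs ys)) ≡ sum (map (λ x → length (filter (P? ∘ (x ,_)) ys)) xs)
  length-filter-cartesianProduct P? []       ys = refl
  length-filter-cartesianProduct P? (x ∷ xs) ys = begin
    length (filter P? (map (x ,_) ys ++ cartesianProduct xs ys))
      ≡⟨ cong length (filter-++ P? (map (x ,_) ys) _) ⟩
    length (filter P? (map (x ,_) ys) ++ filter P? (cartesianProduct xs ys))
      ≡⟨ length-++ (filter P? (map (x ,_) ys)) ⟩
    length (filter P? (map (x ,_) ys)) + length (filter P? (cartesianProduct xs ys))
      ≡⟨ cong₂ _+_ (length-filter-map ys) (length-filter-cartesianProduct P? xs ys) ⟩
    length (filter (P? ∘ (x ,_)) ys) + sum (map (λ x → length (filter (P? ∘ (x ,_)) ys)) xs) ∎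
    where
    open ≡-Reasoning
    length-filter-map : ∀ ys → length (filter P? (map (x ,_) ys)) ≡ length (filter (P? ∘ (x ,_)) ys)
    length-filter-map [] = refl
    length-filter-map (y ∷ ys) with does (P? (x , y))
    ... | true  = cong suc (length-filter-map ys)
    ... | false = length-filter-map ys

module IntegerParity where

  open import Data.Integer as ℤ using (ℤ; +_; ∣_∣; _+_; _-_; _*_)
  open import Data.Integer.DivMod using (_/_; _%_; a≡a%n+[a/n]*n; n%d<d)
  import Data.Integer.Properties as ℤ
  open import Data.Integer.Tactic.RingSolver using (solve-∀)
  open import Data.Nat as ℕ using (zero; suc; _<_; z≤n; s≤s)
  import Data.Nat.Properties as ℕ
  open import Data.Product using (∃-syntax; _,_)
  open import Data.Sum using (_⊎_; inj₁; inj₂)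
  open import Level using (0ℓ)
  open import Relation.Binary.PropositionalEquality
  open import Relation.Nullary using (¬_; yes; no; contradiction)
  open import Relation.Unary using (Pred; Decidable)

  Even Odd : Pred ℤ 0ℓ
  Even x = ∃[ k ] x ≡ k * + 2
  Odd  x = ∃[ k ] x ≡ + 1 + k * + 2

  r+q*d≢q′*d : ∀ {d r} → 0 < r → r < d → ∀ q q′ → + r + q * + d ≢ q′ * + d
  r+q*d≢q′*d {d} {r} 0<r r<d q q′ eq = no-multiple ∣ q′ - q ∣ (begin
      ∣ q′ - q ∣ ℕ.* d                  ≡⟨ ℤ.abs-* (q′ - q) (+ d) ⟨
      ∣ (q′ - q) * + d ∣                ≡⟨ cong ∣_∣ (expand q q′ (+ d)) ⟩
      ∣ q′ * + d - q * + d ∣            ≡⟨ cong (λ e → ∣ e - q * + d ∣) eq ⟨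
      ∣ + r + q * + d - q * + d ∣       ≡⟨ cong ∣_∣ (cancel (+ r) (q * + d)) ⟩
      r                                 ∎)
    where
    open ≡-Reasoning
    expand : ∀ q q′ d → (q′ - q) * d ≡ q′ * d - q * d
    expand = solve-∀
    cancel : ∀ r s → r + s - s ≡ r
    cancel = solve-∀
    no-multiple : ∀ k → k ℕ.* d ≢ r
    no-multiple zero    eq = ℕ.<-irrefl eq 0<r
    no-multiple (suc k) eq = ℕ.<-irrefl refl (ℕ.<-≤-trans r<d (subst (d ℕ.≤_) eq (ℕ.m≤m+n d (k ℕ.* d))))

  even⇒¬odd : ∀ {x} → Even x → ¬ Odd x
  even⇒¬odd (k , refl) (k′ , eq) = r+q*d≢q′*d (s≤s z≤n) (s≤s (s≤s z≤n)) k′ k (sym eq)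

  parity : ∀ x → Even x ⊎ Odd x
  parity x with x % + 2 | n%d<d x (+ 2) | a≡a%n+[a/n]*n x (+ 2)
  ... | 0 | _ | eq = inj₁ (x / + 2 , trans eq (ℤ.+-identityˡ _))
  ... | 1 | _ | eq = inj₂ (x / + 2 , eq)
  ... | suc (suc _) | s≤s (s≤s ()) | _

  odd? : Decidable Odd
  odd? x with parity x
  ... | inj₁ even = no (even⇒¬odd even)
  ... | inj₂ odd  = yes odd

  ¬odd⇒even : ∀ {x} → ¬ Odd x → Even x
  ¬odd⇒even {x} ¬odd with parity x
  ... | inj₁ even = even
  ... | inj₂ odd  = contradiction odd ¬odd

  even+odd⇒odd : ∀ {s t} → Even s → Odd t → Odd (s + t)
  even+odd⇒odd (k , refl) (l , refl) = k + l , regroup k l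
    where
    regroup : ∀ k l → k * + 2 + (+ 1 + l * + 2) ≡ + 1 + (k + l) * + 2
    regroup = solve-∀

  odd+odd⇒even : ∀ {s t} → Odd s → Odd t → Even (s + t)
  odd+odd⇒even (k , refl) (l , refl) = + 1 + k + l , regroup k l
    where
    regroup : ∀ k l → + 1 + k * + 2 + (+ 1 + l * + 2) ≡ (+ 1 + k + l) * + 2
    regroup = solve-∀

  [k*d]/d≡k : ∀ k d .{{_ : ℕ.NonZero d}} → (k * + d) / + d ≡ k
  [k*d]/d≡k k d with (k * + d) % + d | n%d<d (k * + d) (+ d) | a≡a%n+[a/n]*n (k * + d) (+ d)
  ... | zero  | _   | eq = sym (ℤ.*-cancelʳ-≡ k _ (+ d) (trans eq (ℤ.+-identityˡ _)))
  ... | suc r | r<d | eq = contradiction (sym eq) (r+q*d≢q′*d (s≤s z≤n) r<d ((k * + d) / + d) k)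

  odd-2x-1 : ∀ x → Odd (+ 2 * x - + 1)
  odd-2x-1 x = x - + 1 , rearrange x
    where
    rearrange : ∀ x → + 2 * x - + 1 ≡ + 1 + (x - + 1) * + 2
    rearrange = solve-∀

  [2x-1+1]/2≡x : ∀ x → (+ 2 * x - + 1 + + 1) / + 2 ≡ x
  [2x-1+1]/2≡x x = trans (cong (_/ + 2) (rearrange x)) ([k*d]/d≡k x 2)
    where
    rearrange : ∀ x → + 2 * x - + 1 + + 1 ≡ x * + 2
    rearrange = solve-∀

  2[[x+1]/2]-1≡x : ∀ {x} → Odd x → + 2 * ((x + + 1) / + 2) - + 1 ≡ x
  2[[x+1]/2]-1≡x (k , refl) = begin
    + 2 * ((+ 1 + k * + 2 + + 1) / + 2) - + 1  ≡⟨ cong (λ e → + 2 * (e / + 2) - + 1) (regroup k) ⟩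
    + 2 * ((k + + 1) * + 2 / + 2) - + 1        ≡⟨ cong (λ e → + 2 * e - + 1) ([k*d]/d≡k (k + + 1) 2) ⟩
    + 2 * (k + + 1) - + 1                      ≡⟨ expand k ⟩
    + 1 + k * + 2                              ∎
    where
    open ≡-Reasoning
    regroup : ∀ k → + 1 + k * + 2 + + 1 ≡ (k + + 1) * + 2
    regroup = solve-∀
    expand : ∀ k → + 2 * (k + + 1) - + 1 ≡ + 1 + k * + 2
    expand = solve-∀

  [x/2]*2≡x : ∀ {x} → Even x → x / + 2 * + 2 ≡ x
  [x/2]*2≡x (k , refl) = cong (_* + 2) ([k*d]/d≡k k 2)

module TriangularNumbers where

  open import Data.Integer as ℤ using (ℤ; +_; _+_; _-_; _*_)
  open import Data.Integer.DivMod using (_/_)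
  import Data.Integer.Properties as ℤ
  open import Data.Integer.Tactic.RingSolver using (solve-∀)
  open import Data.Product using (_,_)
  open import Data.Sum using (inj₁; inj₂)
  open import Relation.Binary.PropositionalEquality
  open IntegerParity

  x[x-1]-even : ∀ x → Even (x * (x - + 1))
  x[x-1]-even x with parity x
  ... | inj₁ (k , refl) = k * (k * + 2 - + 1) , even-case k
    where
    even-case : ∀ k → k * + 2 * (k * + 2 - + 1) ≡ k * (k * + 2 - + 1) * + 2
    even-case = solve-∀
  ... | inj₂ (k , refl) = (+ 1 + k * + 2) * k , odd-case k
    where
    odd-case : ∀ k → (+ 1 + k * + 2) * (+ 1 + k * + 2 - + 1) ≡ (+ 1 + k * + 2) * k * + 2
    odd-case = solve-∀

  tri*2 : ∀ x → tri x * + 2 ≡ x * (x - + 1)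
  tri*2 x with k , eq ← x[x-1]-even x = begin
    (x * (x - + 1)) / + 2 * + 2  ≡⟨ cong (λ e → e / + 2 * + 2) eq ⟩
    (k * + 2) / + 2 * + 2        ≡⟨ cong (_* + 2) ([k*d]/d≡k k 2) ⟩
    k * + 2                      ≡⟨ eq ⟨
    x * (x - + 1)                ∎
    where open ≡-Reasoning

  sq[2x-1]≡tri[x]*8+1 : ∀ x → sq (+ 2 * x - + 1) ≡ tri x * + 8 + + 1
  sq[2x-1]≡tri[x]*8+1 x = begin
    (+ 2 * x - + 1) * (+ 2 * x - + 1)  ≡⟨ expand x ⟩
    x * (x - + 1) * + 4 + + 1          ≡⟨ cong (λ e → e * + 4 + + 1) (tri*2 x) ⟨
    tri x * + 2 * + 4 + + 1            ≡⟨ regroup (tri x) ⟩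
    tri x * + 8 + + 1                  ∎
    where
    open ≡-Reasoning
    expand : ∀ x → (+ 2 * x - + 1) * (+ 2 * x - + 1) ≡ x * (x - + 1) * + 4 + + 1
    expand = solve-∀
    regroup : ∀ t → t * + 2 * + 4 + + 1 ≡ t * + 8 + + 1
    regroup = solve-∀

  sq[1+k*2]≡tri[k+1]*8+1 : ∀ k → sq (+ 1 + k * + 2) ≡ tri (k + + 1) * + 8 + + 1
  sq[1+k*2]≡tri[k+1]*8+1 k = trans (cong sq (rearrange k)) (sq[2x-1]≡tri[x]*8+1 (k + + 1))
    where
    rearrange : ∀ k → + 1 + k * + 2 ≡ + 2 * (k + + 1) - + 1
    rearrange = solve-∀

  tri[1-x]≡tri[x] : ∀ x → tri (+ 1 - x) ≡ tri x
  tri[1-x]≡tri[x] x = cong (_/ + 2) (numerator x)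
    where
    numerator : ∀ x → (+ 1 - x) * (+ 1 - x - + 1) ≡ x * (x - + 1)
    numerator = solve-∀

  tri-suc : ∀ x → tri (+ 1 + x) ≡ tri x + x
  tri-suc x = ℤ.*-cancelʳ-≡ _ _ (+ 2) (begin
    tri (+ 1 + x) * + 2      ≡⟨ tri*2 (+ 1 + x) ⟩
    (+ 1 + x) * (+ 1 + x - + 1)  ≡⟨ shift x ⟩
    x * (x - + 1) + x * + 2  ≡⟨ cong (λ e → e + x * + 2) (tri*2 x) ⟨
    tri x * + 2 + x * + 2    ≡⟨ ℤ.*-distribʳ-+ (+ 2) (tri x) x ⟨
    (tri x + x) * + 2        ∎)
    where
    open ≡-Reasoning
    shift : ∀ x → (+ 1 + x) * (+ 1 + x - + 1) ≡ x * (x - + 1) + x * + 2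
    shift = solve-∀

module TernaryBoxes where

  open import Data.Bool using (if_then_else_)
  open import Data.Integer as ℤ using (ℤ; +_; -[1+_]; ∣_∣; _+_; _-_; _*_; -_; _≟_)
  import Data.Integer.Properties as ℤ
  open import Algebra.Properties.AbelianGroup ℤ.+-0-abelianGroup using () renaming (∙-cancelʳ to +-cancelʳ-≡)
  open import Data.Integer.Tactic.RingSolver using (solve-∀)
  open import Data.List using (List; []; _∷_; map; length; filter; cartesianProduct)
  open import Data.List.Properties using (map-cong)
  open import Data.List.Membership.Propositional using (_∈_)
  open import Data.List.Membership.Propositional.Properties using (∈-map⁺; ∈-upTo⁺; ∈-cartesianProduct⁺)
  open import Data.List.Relation.Unary.Unique.Propositional using (Unique)
  import Data.List.Relation.Unary.Unique.Propositional.Properties as Unique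
  open import Data.Nat as ℕ using (ℕ; zero; suc; _≤_; z≤n; s≤s)
  open import Data.Nat.ListAction using (sum)
  import Data.Nat.Properties as ℕ
  open import Data.Product using (_×_; _,_; ∃-syntax)
  open import Function using (_∘_)
  open import Function.Bundles using (mk⇔)
  open import Relation.Binary.PropositionalEquality
  open import Level using (0ℓ)
  open import Relation.Nullary using (does)
  open import Relation.Nullary.Decidable using (does-⇔)
  open import Relation.Unary using (Pred; Decidable; _⊆_)
  open FilterCounting
  open TriangularNumbers

  ℤ³ : Set
  ℤ³ = ℤ × ℤ × ℤ

  form : (ℤ → ℤ) → ℤ³ → ℤ³ → ℤ
  form f (a , b , c) (x , y , z) = a * f x + b * f y + c * f z

  box : ℕ → List ℤ³
  box B = cartesianProduct (range B) (cartesianProduct (range B) (range B))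

  reps-ternary : ∀ f B a b c r → reps f B (a ∷ b ∷ c ∷ []) r
    ≡ length (filter (λ v → form f (+ a , + b , + c) v ≟ r) (box B))
  reps-ternary f B a b c r = sym (begin
    length (filter F? (box B))
      ≡⟨ length-filter-cartesianProduct F? (range B) (cartesianProduct (range B) (range B)) ⟩
    sum (map (λ x → length (filter (F? ∘ (x ,_)) (cartesianProduct (range B) (range B)))) (range B))
      ≡⟨ sum-cong (λ x → trans (length-filter-cartesianProduct (F? ∘ (x ,_)) (range B) (range B))
           (sum-cong (λ y → trans (sym (sum-indicator≡length-filter (F? ∘ (x ,_) ∘ (y ,_)) (range B)))
             (sum-cong (λ z → cong (if_then 1 else 0) (does-residual x y z)))))) ⟩
    reps f B (a ∷ b ∷ c ∷ []) r ∎)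
    where
    open ≡-Reasoning
    F? = λ v → form f (+ a , + b , + c) v ≟ r
    sum-cong : ∀ {g h : ℤ → ℕ} → (∀ x → g x ≡ h x) → sum (map g (range B)) ≡ sum (map h (range B))
    sum-cong g≡h = cong sum (map-cong g≡h (range B))
    regroup : ∀ r p q s → r - p - q - s ≡ r - (p + q + s)
    regroup = solve-∀
    does-residual : ∀ x y z → does (F? (x , y , z))
      ≡ does (r - + a * f x - + b * f y - + c * f z ≟ + 0)
    does-residual x y z = does-⇔ (mk⇔
      (λ eq → trans residual (ℤ.i≡j⇒i-j≡0 (sym eq)))
      (λ eq → sym (ℤ.i-j≡0⇒i≡j r _ (trans (sym residual) eq))))
      (F? (x , y , z)) (r - + a * f x - + b * f y - + c * f z ≟ + 0)
      where residual = regroup r (+ a * f x) (+ b * f y) (+ c * f z)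

  range-unique : ∀ B → Unique (range B)
  range-unique B = Unique.map⁺ shift-injective (Unique.upTo⁺ _)
    where
    shift-injective : ∀ {i j} → + i - + B ≡ + j - + B → i ≡ j
    shift-injective {i} {j} eq = ℤ.+-injective (+-cancelʳ-≡ (- + B) (+ i) (+ j) eq)

  box-unique : ∀ B → Unique (box B)
  box-unique B = Unique.cartesianProduct⁺ (range-unique B)
    (Unique.cartesianProduct⁺ (range-unique B) (range-unique B))

  ∈-range : ∀ {B} x → ∣ x ∣ ≤ B → x ∈ range B
  ∈-range {B} (+ k) k≤B = subst (_∈ range B) (shift-back (+ k) (+ B))
    (∈-map⁺ (λ i → + i - + B) (∈-upTo⁺ (s≤s k+B≤2*B)))
    where
    shift-back : ∀ x y → x + y - y ≡ x
    shift-back = solve-∀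
    k+B≤2*B : k ℕ.+ B ≤ 2 ℕ.* B
    k+B≤2*B = subst (k ℕ.+ B ≤_) (cong (B ℕ.+_) (sym (ℕ.+-identityʳ B))) (ℕ.+-monoˡ-≤ B k≤B)
  ∈-range {B} -[1+ k ] 1+k≤B = subst (λ b → -[1+ k ] ∈ range b) (ℕ.m∸n+n≡m 1+k≤B)
    (subst (_∈ range (j ℕ.+ suc k)) (shift-back (+ j) (+ suc k))
      (∈-map⁺ (λ i → + i - + (j ℕ.+ suc k)) (∈-upTo⁺ (s≤s j≤2*[j+1+k]))))
    where
    j = B ℕ.∸ suc k
    j≤2*[j+1+k] : j ≤ 2 ℕ.* (j ℕ.+ suc k)
    j≤2*[j+1+k] = ℕ.≤-trans (ℕ.m≤m+n j (suc k)) (ℕ.m≤m+n _ _)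
    shift-back : ∀ x y → x - (x + y) ≡ - y
    shift-back = solve-∀

  ∈-box : ∀ {B x y z} → ∣ x ∣ ≤ B → ∣ y ∣ ≤ B → ∣ z ∣ ≤ B → (x , y , z) ∈ box B
  ∈-box {x = x} {y} {z} x≤ y≤ z≤ =
    ∈-cartesianProduct⁺ (∈-range x x≤) (∈-cartesianProduct⁺ (∈-range y y≤) (∈-range z z≤))

  length-filter-box-correspondence : ∀ {P Q : Pred ℤ³ 0ℓ} (P? : Decidable P) (Q? : Decidable Q) B B′ →
    P ⊆ (_∈ box B) → Q ⊆ (_∈ box B′) → Correspondence P Q →
    length (filter P? (box B)) ≡ length (filter Q? (box B′))
  length-filter-box-correspondence P? Q? B B′ =
    length-filter-correspondence P? Q? (box-unique B) (box-unique B′)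

  cong-ℤ³ : ∀ {x x′ y y′ z z′ : ℤ} → x ≡ x′ → y ≡ y′ → z ≡ z′ → (x , y , z) ≡ (x′ , y′ , z′)
  cong-ℤ³ refl refl refl = refl

  Coercive : ℕ → (ℤ → ℤ) → Set
  Coercive d f = ∀ x → ∃[ t ] f x ≡ + t × ∣ x ∣ ≤ d ℕ.+ t

  sq-coercive : Coercive 0 sq
  sq-coercive (+ k)    = k ℕ.* k , sym (ℤ.pos-* k k) , k≤k*k k
    where
    k≤k*k : ∀ k → k ≤ k ℕ.* k
    k≤k*k zero    = z≤n
    k≤k*k (suc k) = ℕ.m≤m*n (suc k) (suc k)
  sq-coercive -[1+ k ] = suc k ℕ.* suc k , refl , ℕ.m≤m*n (suc k) (suc k)

  tri-coercive : Coercive 1 tri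
  tri-coercive (+ k)    = tri-natural k
    where
    tri-natural : ∀ k → ∃[ t ] tri (+ k) ≡ + t × k ≤ suc t
    tri-natural zero    = 0 , refl , z≤n
    tri-natural (suc k) = step (tri-natural k)
      where
      step : ∃[ t ] tri (+ k) ≡ + t × k ≤ suc t → ∃[ t ] tri (+ suc k) ≡ + t × suc k ≤ suc t
      step (t , tri≡t , _) = t ℕ.+ k , trans (tri-suc (+ k)) (cong (_+ + k) tri≡t) , s≤s (ℕ.m≤n+m k t)
  tri-coercive -[1+ k ] = reflected (tri-coercive (+ suc (suc k)))
    where
    reflected : ∃[ t ] tri (+ suc (suc k)) ≡ + t × suc (suc k) ≤ suc t →
                ∃[ t ] tri -[1+ k ] ≡ + t × suc k ≤ suc t
    reflected (t , tri≡t , 2+k≤1+t) =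
      t , trans (sym (tri[1-x]≡tri[x] -[1+ k ])) tri≡t , ℕ.m≤n⇒m≤1+n (ℕ.s≤s⁻¹ 2+k≤1+t)

  solutions-in-box : ∀ {d f} → Coercive d f → ∀ {a b c R} → 1 ≤ a → 1 ≤ b → 1 ≤ c →
    ∀ {v} → form f (+ a , + b , + c) v ≡ + R → v ∈ box (d ℕ.+ R)
  solutions-in-box {d} {f} coercive {a} {b} {c} {R} 1≤a 1≤b 1≤c {x , y , z} eq
    with s , fx≡s , x≤ ← coercive x | t , fy≡t , y≤ ← coercive y | u , fz≡u , z≤ ← coercive z =
    ∈-box (bound x≤ (term≤ a s 1≤a (ℕ.≤-trans (ℕ.m≤m+n _ _) (ℕ.m≤m+n _ _))))
          (bound y≤ (term≤ b t 1≤b (ℕ.≤-trans (ℕ.m≤n+m _ (a ℕ.* s)) (ℕ.m≤m+n _ _))))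
          (bound z≤ (term≤ c u 1≤c (ℕ.m≤n+m _ _)))
    where
    open ≡-Reasoning
    sum≡R : a ℕ.* s ℕ.+ b ℕ.* t ℕ.+ c ℕ.* u ≡ R
    sum≡R = ℤ.+-injective (begin
      + (a ℕ.* s ℕ.+ b ℕ.* t ℕ.+ c ℕ.* u)
        ≡⟨ cong₂ _+_ (cong₂ _+_ (ℤ.pos-* a s) (ℤ.pos-* b t)) (ℤ.pos-* c u) ⟩
      + a * + s + + b * + t + + c * + u
        ≡⟨ cong₂ _+_ (cong₂ _+_ (cong (+ a *_) fx≡s) (cong (+ b *_) fy≡t)) (cong (+ c *_) fz≡u) ⟨
      form f (+ a , + b , + c) (x , y , z)
        ≡⟨ eq ⟩
      + R ∎)
    term≤ : ∀ k w → 1 ≤ k → k ℕ.* w ≤ a ℕ.* s ℕ.+ b ℕ.* t ℕ.+ c ℕ.* u → w ≤ R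
    term≤ k w 1≤k k*w≤ = ℕ.≤-trans (ℕ.m≤n*m w k {{ℕ.>-nonZero 1≤k}}) (subst (k ℕ.* w ≤_) sum≡R k*w≤)
    bound : ∀ {i w} → i ≤ d ℕ.+ w → w ≤ R → i ≤ d ℕ.+ R
    bound i≤ w≤R = ℕ.≤-trans i≤ (ℕ.+-monoʳ-≤ d w≤R)

module QuadraticForm (α μ n : ℤ) where

  open import Data.Empty using (⊥-elim)
  open import Data.Integer as ℤ using (ℤ; +_; _+_; _-_; _*_; -_; _≟_)
  open import Data.Integer.DivMod using (_/_)
  import Data.Integer.Properties as ℤ
  open import Algebra.Properties.AbelianGroup ℤ.+-0-abelianGroup using () renaming (∙-cancelʳ to +-cancelʳ-≡)
  open import Data.Integer.Tactic.RingSolver using (solve-∀)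
  open import Data.Nat as ℕ using (z≤n; s≤s)
  import Data.Nat.Properties as ℕ
  open import Data.Product using (_×_; _,_; proj₁; proj₂; ∃-syntax)
  open import Data.Sum using (_⊎_; inj₁; inj₂; [_,_]′)
  open import Level using (0ℓ)
  open import Relation.Binary.PropositionalEquality
  open import Relation.Nullary using (¬_)
  open import Relation.Unary using (Pred; Decidable; ∁; _∩_)
  open FilterCounting using (Correspondence)
  open IntegerParity
  open TriangularNumbers
  open TernaryBoxes using (ℤ³; form; cong-ℤ³)

  A B L : ℤ
  A = + 1 + α * + 2
  B = + 4 + μ * + 8
  L = n + (α + μ + + 1)

  Q : (ℤ → ℤ) → ℤ³ → ℤ
  Q f = form f (A , + 3 * A , B)

  -- Q f (x , y , z) unfolds to diag (f x) (f y) (f z), so diag-cong rewrites the values of f.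
  diag : ℤ → ℤ → ℤ → ℤ
  diag X Y Z = A * X + + 3 * A * Y + B * Z

  diag-cong : ∀ {X X′ Y Y′ Z Z′} → X ≡ X′ → Y ≡ Y′ → Z ≡ Z′ → diag X Y Z ≡ diag X′ Y′ Z′
  diag-cong refl refl refl = refl

  T M K : Pred ℤ³ 0ℓ
  T v = Q tri v ≡ n
  M v = Q sq v ≡ L * + 8
  K v = Q sq v ≡ L * + 2

  T? : Decidable T
  T? v = Q tri v ≟ n
  M? : Decidable M
  M? v = Q sq v ≟ L * + 8
  K? : Decidable K
  K? v = Q sq v ≟ L * + 2

  OddX OddZ OddSum : Pred ℤ³ 0ℓ
  OddX   (x , _ , _) = Odd x
  OddZ   (_ , _ , z) = Odd z
  OddSum (x , y , _) = Odd (x + y)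

  oddX? : Decidable OddX
  oddX? (x , _ , _) = odd? x
  oddZ? : Decidable OddZ
  oddZ? (_ , _ , z) = odd? z
  oddSum? : Decidable OddSum
  oddSum? (x , y , _) = odd? (x + y)

  -- The quotients are written out: Agda cannot infer k from an equation ending in k * + d.
  Q-sq[odd,even,z]-odd : ∀ p q z → Odd (Q sq (+ 1 + p * + 2 , q * + 2 , z))
  Q-sq[odd,even,z]-odd p q z =
    α + A * (p * p + p) * + 2 + A * q * q * + 6 + (+ 2 + μ * + 4) * sq z , identity α μ p q (sq z)
    where
    identity : ∀ α μ p q s →
      (+ 1 + α * + 2) * ((+ 1 + p * + 2) * (+ 1 + p * + 2))
        + + 3 * (+ 1 + α * + 2) * ((q * + 2) * (q * + 2)) + (+ 4 + μ * + 8) * s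
      ≡ + 1 + (α + (+ 1 + α * + 2) * (p * p + p) * + 2 + (+ 1 + α * + 2) * q * q * + 6
                 + (+ 2 + μ * + 4) * s) * + 2
    identity = solve-∀

  Q-sq[even,odd,z]-odd : ∀ p q z → Odd (Q sq (p * + 2 , + 1 + q * + 2 , z))
  Q-sq[even,odd,z]-odd p q z =
    + 1 + α * + 3 + A * p * p * + 2 + A * (q * q + q) * + 6 + (+ 2 + μ * + 4) * sq z , identity α μ p q (sq z)
    where
    identity : ∀ α μ p q s →
      (+ 1 + α * + 2) * ((p * + 2) * (p * + 2))
        + + 3 * (+ 1 + α * + 2) * ((+ 1 + q * + 2) * (+ 1 + q * + 2)) + (+ 4 + μ * + 8) * s
      ≡ + 1 + (+ 1 + α * + 3 + (+ 1 + α * + 2) * p * p * + 2 + (+ 1 + α * + 2) * (q * q + q) * + 6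
                 + (+ 2 + μ * + 4) * s) * + 2
    identity = solve-∀

  Q-sq[odd,odd,even]≡4-mod-8 : ∀ p q w →
    ∃[ k ] Q sq (+ 1 + p * + 2 , + 1 + q * + 2 , w * + 2) ≡ + 4 + k * + 8
  Q-sq[odd,odd,even]≡4-mod-8 p q w =
    α + A * tri (p + + 1) + A * tri (q + + 1) * + 3 + (+ 2 + μ * + 4) * w * w ,
    trans (diag-cong (sq[1+k*2]≡tri[k+1]*8+1 p) (sq[1+k*2]≡tri[k+1]*8+1 q) refl)
          (identity α μ (tri (p + + 1)) (tri (q + + 1)) w)
    where
    identity : ∀ α μ s t w →
      (+ 1 + α * + 2) * (s * + 8 + + 1) + + 3 * (+ 1 + α * + 2) * (t * + 8 + + 1)
        + (+ 4 + μ * + 8) * ((w * + 2) * (w * + 2))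
      ≡ + 4 + (α + (+ 1 + α * + 2) * s + (+ 1 + α * + 2) * t * + 3 + (+ 2 + μ * + 4) * w * w) * + 8
    identity = solve-∀

  Q-sq[4s,4t,odd]≡4-mod-8 : ∀ s t h →
    ∃[ k ] Q sq (s * + 2 * + 2 , t * + 2 * + 2 , + 1 + h * + 2) ≡ + 4 + k * + 8
  Q-sq[4s,4t,odd]≡4-mod-8 s t h =
    A * s * s * + 2 + A * t * t * + 6 + μ + B * tri (h + + 1) ,
    trans (diag-cong refl refl (sq[1+k*2]≡tri[k+1]*8+1 h)) (identity α μ s t (tri (h + + 1)))
    where
    identity : ∀ α μ s t u →
      (+ 1 + α * + 2) * ((s * + 2 * + 2) * (s * + 2 * + 2))
        + + 3 * (+ 1 + α * + 2) * ((t * + 2 * + 2) * (t * + 2 * + 2)) + (+ 4 + μ * + 8) * (u * + 8 + + 1)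
      ≡ + 4 + ((+ 1 + α * + 2) * s * s * + 2 + (+ 1 + α * + 2) * t * t * + 6 + μ + (+ 4 + μ * + 8) * u) * + 8
    identity = solve-∀

  Q-sq[4s+2,4t+2,odd]≡4-mod-8 : ∀ s t h →
    ∃[ k ] Q sq ((+ 1 + s * + 2) * + 2 , (+ 1 + t * + 2) * + 2 , + 1 + h * + 2) ≡ + 4 + k * + 8
  Q-sq[4s+2,4t+2,odd]≡4-mod-8 s t h =
    + 2 + α * + 4 + A * tri (s + + 1) * + 4 + A * tri (t + + 1) * + 12 + μ + B * tri (h + + 1) ,
    trans (diag-cong (quadruple-odd s) (quadruple-odd t) (sq[1+k*2]≡tri[k+1]*8+1 h))
          (identity α μ (tri (s + + 1)) (tri (t + + 1)) (tri (h + + 1)))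
    where
    sq-double : ∀ x → (x * + 2) * (x * + 2) ≡ x * x * + 4
    sq-double = solve-∀
    quadruple-odd : ∀ s → sq ((+ 1 + s * + 2) * + 2) ≡ (tri (s + + 1) * + 8 + + 1) * + 4
    quadruple-odd s = trans (sq-double (+ 1 + s * + 2)) (cong (_* + 4) (sq[1+k*2]≡tri[k+1]*8+1 s))
    identity : ∀ α μ s t u →
      (+ 1 + α * + 2) * ((s * + 8 + + 1) * + 4) + + 3 * (+ 1 + α * + 2) * ((t * + 8 + + 1) * + 4)
        + (+ 4 + μ * + 8) * (u * + 8 + + 1)
      ≡ + 4 + (+ 2 + α * + 4 + (+ 1 + α * + 2) * s * + 4 + (+ 1 + α * + 2) * t * + 12 + μ
                 + (+ 4 + μ * + 8) * u) * + 8
    identity = solve-∀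

  Q-sq[even,even,z]≡0-mod-4 : ∀ s t w → ∃[ k ] Q sq (s * + 2 , t * + 2 , w) ≡ k * + 4
  Q-sq[even,even,z]≡0-mod-4 s t w =
    A * s * s + A * t * t * + 3 + (+ 1 + μ * + 2) * w * w , identity α μ s t w
    where
    identity : ∀ α μ s t w →
      (+ 1 + α * + 2) * ((s * + 2) * (s * + 2)) + + 3 * (+ 1 + α * + 2) * ((t * + 2) * (t * + 2))
        + (+ 4 + μ * + 8) * (w * w)
      ≡ ((+ 1 + α * + 2) * s * s + (+ 1 + α * + 2) * t * t * + 3 + (+ 1 + μ * + 2) * w * w) * + 4
    identity = solve-∀

  Q-sq[odd,odd,z]≡0-mod-4 : ∀ p q w → ∃[ k ] Q sq (+ 1 + p * + 2 , + 1 + q * + 2 , w) ≡ k * + 4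
  Q-sq[odd,odd,z]≡0-mod-4 p q w =
    A * (+ 1 + p * p + p + (q * q + q) * + 3) + (+ 1 + μ * + 2) * w * w , identity α μ p q w
    where
    identity : ∀ α μ p q w →
      (+ 1 + α * + 2) * ((+ 1 + p * + 2) * (+ 1 + p * + 2))
        + + 3 * (+ 1 + α * + 2) * ((+ 1 + q * + 2) * (+ 1 + q * + 2)) + (+ 4 + μ * + 8) * (w * w)
      ≡ ((+ 1 + α * + 2) * (+ 1 + p * p + p + (q * q + q) * + 3) + (+ 1 + μ * + 2) * w * w) * + 4
    identity = solve-∀

  M⇒Q-even : ∀ v → M v → Even (Q sq v)
  M⇒Q-even _ m = L * + 4 , trans m (regroup L)
    where
    regroup : ∀ L → L * + 8 ≡ L * + 4 * + 2
    regroup = solve-∀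

  4-mod-8⇒≢L*8 : ∀ {X} → ∃[ k ] X ≡ + 4 + k * + 8 → X ≢ L * + 8
  4-mod-8⇒≢L*8 (k , eq) eq′ = r+q*d≢q′*d (s≤s z≤n) (ℕ.m<m+n 4 (s≤s z≤n)) k L (trans (sym eq) eq′)

  Q-even⇒same-parity : ∀ x y z → Even (Q sq (x , y , z)) → (Even x × Even y) ⊎ (Odd x × Odd y)
  Q-even⇒same-parity x y z = cases (parity x) (parity y)
    where
    cases : ∀ {x y} → Even x ⊎ Odd x → Even y ⊎ Odd y →
      Even (Q sq (x , y , z)) → (Even x × Even y) ⊎ (Odd x × Odd y)
    cases (inj₁ even-x)     (inj₁ even-y)     _    = inj₁ (even-x , even-y)
    cases (inj₂ odd-x)      (inj₂ odd-y)      _    = inj₂ (odd-x , odd-y)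
    cases (inj₂ (p , refl)) (inj₁ (q , refl)) even = ⊥-elim (even⇒¬odd even (Q-sq[odd,even,z]-odd p q z))
    cases (inj₁ (p , refl)) (inj₂ (q , refl)) even = ⊥-elim (even⇒¬odd even (Q-sq[even,odd,z]-odd p q z))

  M∩EvenX⇒EvenY : ∀ x y z → M (x , y , z) → Even x → Even y
  M∩EvenX⇒EvenY x y z m even-x = [ proj₂ , (λ (odd-x , _) → ⊥-elim (even⇒¬odd even-x odd-x)) ]′
    (Q-even⇒same-parity x y z (M⇒Q-even (x , y , z) m))

  M∩OddX⇒OddY : ∀ x y z → M (x , y , z) → Odd x → Odd y
  M∩OddX⇒OddY x y z m odd-x = [ (λ (even-x , _) → ⊥-elim (even⇒¬odd even-x odd-x)) , proj₂ ]′
    (Q-even⇒same-parity x y z (M⇒Q-even (x , y , z) m))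

  M∩OddX∩OddY⇒OddZ : ∀ {x y z} → Odd x → Odd y → Even z ⊎ Odd z → M (x , y , z) → Odd z
  M∩OddX∩OddY⇒OddZ _          _          (inj₂ odd-z)     _ = odd-z
  M∩OddX∩OddY⇒OddZ (p , refl) (q , refl) (inj₁ (w , refl)) m =
    ⊥-elim (4-mod-8⇒≢L*8 (Q-sq[odd,odd,even]≡4-mod-8 p q w) m)

  M∩OddX⇒OddY∩OddZ : ∀ x y z → M (x , y , z) → Odd x → Odd y × Odd z
  M∩OddX⇒OddY∩OddZ x y z m odd-x = odd-y , M∩OddX∩OddY⇒OddZ odd-x odd-y (parity z) m
    where
    odd-y = M∩OddX⇒OddY x y z m odd-x

  M∩EvenX∩EvenY∩OddZ⇒4∣y-x+2 : ∀ {x y z} → Even x → Even y → Odd z → M (x , y , z) →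
    ∃[ k ] y - x + + 2 ≡ k * + 4
  -- 4 ∣ 2v − 2u + 2 iff u and v have different parities; equal parities make Q ≡ 4 (mod 8).
  M∩EvenX∩EvenY∩OddZ⇒4∣y-x+2 (u , refl) (v , refl) (h , refl) = cases (parity u) (parity v)
    where
    cases : ∀ {u v} → Even u ⊎ Odd u → Even v ⊎ Odd v →
      M (u * + 2 , v * + 2 , + 1 + h * + 2) → ∃[ k ] v * + 2 - u * + 2 + + 2 ≡ k * + 4
    cases (inj₁ (s , refl)) (inj₂ (t , refl)) _ = + 1 + t - s , regroup s t
      where
      regroup : ∀ s t → (+ 1 + t * + 2) * + 2 - s * + 2 * + 2 + + 2 ≡ (+ 1 + t - s) * + 4
      regroup = solve-∀
    cases (inj₂ (s , refl)) (inj₁ (t , refl)) _ = t - s , regroup s t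
      where
      regroup : ∀ s t → t * + 2 * + 2 - (+ 1 + s * + 2) * + 2 + + 2 ≡ (t - s) * + 4
      regroup = solve-∀
    cases (inj₁ (s , refl)) (inj₁ (t , refl)) m =
      ⊥-elim (4-mod-8⇒≢L*8 (Q-sq[4s,4t,odd]≡4-mod-8 s t h) m)
    cases (inj₂ (s , refl)) (inj₂ (t , refl)) m =
      ⊥-elim (4-mod-8⇒≢L*8 (Q-sq[4s+2,4t+2,odd]≡4-mod-8 s t h) m)

  Q-sq≢2+h*4 : ∀ v h → Q sq v ≢ + 2 + h * + 4
  Q-sq≢2+h*4 (x , y , z) h eq = excluded (Q-even⇒same-parity x y z (+ 1 + h * + 2 , trans eq (regroup h))) eq
    where
    regroup : ∀ h → + 2 + h * + 4 ≡ (+ 1 + h * + 2) * + 2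
    regroup = solve-∀
    0-mod-4⇒≢ : ∀ {X} → ∃[ k ] X ≡ k * + 4 → X ≢ + 2 + h * + 4
    0-mod-4⇒≢ (k , eq) eq′ = r+q*d≢q′*d (s≤s z≤n) (ℕ.m<m+n 2 (s≤s z≤n)) h k (trans (sym eq′) eq)
    excluded : ∀ {x y} → (Even x × Even y) ⊎ (Odd x × Odd y) → Q sq (x , y , z) ≢ + 2 + h * + 4
    excluded (inj₁ ((s , refl) , (t , refl))) = 0-mod-4⇒≢ (Q-sq[even,even,z]≡0-mod-4 s t z)
    excluded (inj₂ ((p , refl) , (q , refl))) = 0-mod-4⇒≢ (Q-sq[odd,odd,z]≡0-mod-4 p q z)

  K-empty : Odd L → ∀ v → ¬ K v
  K-empty (h , L≡) v k = Q-sq≢2+h*4 v h (trans k (trans (cong (_* + 2) L≡) (regroup h)))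
    where
    regroup : ∀ h → (+ 1 + h * + 2) * + 2 ≡ + 2 + h * + 4
    regroup = solve-∀

  lift : ℤ³ → ℤ³
  lift (x , y , z) = + 2 * x - + 1 , + 2 * y - + 1 , + 2 * z - + 1

  Q-sq-lift : ∀ v → Q sq (lift v) ≡ (Q tri v + (α + μ + + 1)) * + 8
  Q-sq-lift (x , y , z) =
    trans (diag-cong (sq[2x-1]≡tri[x]*8+1 x) (sq[2x-1]≡tri[x]*8+1 y) (sq[2x-1]≡tri[x]*8+1 z))
          (identity α μ (tri x) (tri y) (tri z))
    where
    identity : ∀ α μ s t u →
      (+ 1 + α * + 2) * (s * + 8 + + 1) + + 3 * (+ 1 + α * + 2) * (t * + 8 + + 1)
        + (+ 4 + μ * + 8) * (u * + 8 + + 1)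
      ≡ ((+ 1 + α * + 2) * s + + 3 * (+ 1 + α * + 2) * t + (+ 4 + μ * + 8) * u + (α + μ + + 1)) * + 8
    identity = solve-∀

  T⇒M∘lift : ∀ v → T v → M (lift v)
  T⇒M∘lift v t = trans (Q-sq-lift v) (cong (λ e → (e + (α + μ + + 1)) * + 8) t)

  M∘lift⇒T : ∀ v → M (lift v) → T v
  M∘lift⇒T v m = +-cancelʳ-≡ (α + μ + + 1) _ _ (ℤ.*-cancelʳ-≡ _ _ (+ 8) (trans (sym (Q-sq-lift v)) m))

  T↔M∩OddX : Correspondence T (M ∩ OddX)
  T↔M∩OddX = record
    { to      = lift
    ; from    = lower
    ; to-⊆    = λ {v} t → T⇒M∘lift v t , odd-2x-1 (proj₁ v)
    ; from-⊆  = λ {w} (m , odd-x) → M∘lift⇒T (lower w) (subst M (sym (lift∘lower w m odd-x)) m)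
    ; from∘to = λ {v} _ → lower∘lift v
    ; to∘from = λ {w} (m , odd-x) → lift∘lower w m odd-x
    }
    where
    lower : ℤ³ → ℤ³
    lower (x , y , z) = (x + + 1) / + 2 , (y + + 1) / + 2 , (z + + 1) / + 2
    lower∘lift : ∀ v → lower (lift v) ≡ v
    lower∘lift (x , y , z) = cong-ℤ³ ([2x-1+1]/2≡x x) ([2x-1+1]/2≡x y) ([2x-1+1]/2≡x z)
    lift∘lower : ∀ w → M w → OddX w → lift (lower w) ≡ w
    lift∘lower (x , y , z) m odd-x =
      let odd-y , odd-z = M∩OddX⇒OddY∩OddZ x y z m odd-x
      in cong-ℤ³ (2[[x+1]/2]-1≡x odd-x) (2[[x+1]/2]-1≡x odd-y) (2[[x+1]/2]-1≡x odd-z)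

  reflect : ℤ³ → ℤ³
  reflect (x , y , z) = x , + 1 - y , z

  T∩∁OddSum↔T∩OddSum : Correspondence (T ∩ ∁ OddSum) (T ∩ OddSum)
  T∩∁OddSum↔T∩OddSum = record
    { to      = reflect
    ; from    = reflect
    ; to-⊆    = λ {v} (t , ¬odd) → T⇒T∘reflect v t , ∁OddSum⇒OddSum∘reflect v ¬odd
    ; from-⊆  = λ {v} (t , odd) → T⇒T∘reflect v t , OddSum⇒∁OddSum∘reflect v odd
    ; from∘to = λ {v} _ → reflect-involutive v
    ; to∘from = λ {v} _ → reflect-involutive v
    }
    where
    T⇒T∘reflect : ∀ v → T v → T (reflect v)
    T⇒T∘reflect (x , y , z) = trans (diag-cong refl (tri[1-x]≡tri[x] y) refl)
    sum-reflect : ∀ x y → x + (+ 1 - y) ≡ x + y + (+ 1 + - y * + 2)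
    sum-reflect = solve-∀
    ∁OddSum⇒OddSum∘reflect : ∀ v → ¬ OddSum v → OddSum (reflect v)
    ∁OddSum⇒OddSum∘reflect (x , y , _) ¬odd =
      subst Odd (sym (sum-reflect x y)) (even+odd⇒odd (¬odd⇒even ¬odd) (- y , refl))
    OddSum⇒∁OddSum∘reflect : ∀ v → OddSum v → ¬ OddSum (reflect v)
    OddSum⇒∁OddSum∘reflect (x , y , _) odd =
      even⇒¬odd (subst Even (sym (sum-reflect x y)) (odd+odd⇒even odd (- y , refl)))
    reflect-involutive : ∀ v → reflect (reflect v) ≡ v
    reflect-involutive (x , y , z) = cong-ℤ³ refl (1-[1-y]≡y y) refl
      where
      1-[1-y]≡y : ∀ y → + 1 - (+ 1 - y) ≡ y
      1-[1-y]≡y = solve-∀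

  -- rotate is the automorphism (X, Y) ↦ ((X − 3Y)/2, (X + Y)/2) of X² + 3Y² applied to lift;
  -- the division in unrotate is exact only when 4 ∣ y − x + 2.
  rotate unrotate : ℤ³ → ℤ³
  rotate (x , y , z) = x - + 3 * y + + 1 , x + y - + 1 , + 2 * z - + 1
  unrotate (x , y , z) = y + + 1 - k , k , (z + + 1) / + 2
    where
    k = (y - x + + 2) / + 4

  Q-sq-rotate : ∀ v → Q sq (rotate v) ≡ Q sq (lift v)
  Q-sq-rotate (x , y , z) = identity α μ x y (sq (+ 2 * z - + 1))
    where
    identity : ∀ α μ x y s →
      (+ 1 + α * + 2) * ((x - + 3 * y + + 1) * (x - + 3 * y + + 1))
        + + 3 * (+ 1 + α * + 2) * ((x + y - + 1) * (x + y - + 1)) + (+ 4 + μ * + 8) * s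
      ≡ (+ 1 + α * + 2) * ((+ 2 * x - + 1) * (+ 2 * x - + 1))
        + + 3 * (+ 1 + α * + 2) * ((+ 2 * y - + 1) * (+ 2 * y - + 1)) + (+ 4 + μ * + 8) * s
    identity = solve-∀

  unrotate∘rotate : ∀ v → unrotate (rotate v) ≡ v
  unrotate∘rotate (x , y , z) =
    cong-ℤ³ (trans (cong (λ k → x + y - + 1 + + 1 - k) k≡y) (cancel x y)) k≡y ([2x-1+1]/2≡x z)
    where
    regroup : ∀ x y → x + y - + 1 - (x - + 3 * y + + 1) + + 2 ≡ y * + 4
    regroup = solve-∀
    cancel : ∀ x y → x + y - + 1 + + 1 - y ≡ x
    cancel = solve-∀
    k≡y : (x + y - + 1 - (x - + 3 * y + + 1) + + 2) / + 4 ≡ y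
    k≡y = trans (cong (_/ + 4) (regroup x y)) ([k*d]/d≡k y 4)

  rotate∘unrotate : ∀ {x y z} k → y - x + + 2 ≡ k * + 4 → Odd z → rotate (unrotate (x , y , z)) ≡ (x , y , z)
  rotate∘unrotate {x} {y} {z} k eq odd-z = cong-ℤ³ first (second y q) (2[[x+1]/2]-1≡x odd-z)
    where
    open ≡-Reasoning
    q = (y - x + + 2) / + 4
    q≡k : q ≡ k
    q≡k = trans (cong (_/ + 4) eq) ([k*d]/d≡k k 4)
    regroup : ∀ y q → y + + 1 - q - + 3 * q + + 1 ≡ y + + 2 - q * + 4
    regroup = solve-∀
    cancel : ∀ x y → y + + 2 - (y - x + + 2) ≡ x
    cancel = solve-∀
    first : y + + 1 - q - + 3 * q + + 1 ≡ x
    first = begin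
      y + + 1 - q - + 3 * q + + 1  ≡⟨ regroup y q ⟩
      y + + 2 - q * + 4            ≡⟨ cong (λ e → y + + 2 - e * + 4) q≡k ⟩
      y + + 2 - k * + 4            ≡⟨ cong (λ e → y + + 2 - e) eq ⟨
      y + + 2 - (y - x + + 2)      ≡⟨ cancel x y ⟩
      x                            ∎
    second : ∀ y q → y + + 1 - q + q - + 1 ≡ y
    second = solve-∀

  T∩OddSum↔M∩∁OddX∩OddZ : Correspondence (T ∩ OddSum) ((M ∩ ∁ OddX) ∩ OddZ)
  T∩OddSum↔M∩∁OddX∩OddZ = record
    { to      = rotate
    ; from    = unrotate
    ; to-⊆    = λ {v} (t , odd-sum) →
                  (T⇒M∘rotate v t , OddSum⇒∁OddX∘rotate v odd-sum) , odd-2x-1 (proj₂ (proj₂ v))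
    ; from-⊆  = λ {w} ((m , ¬odd-x) , odd-z) → M⇒T∘unrotate w m ¬odd-x odd-z , M⇒OddSum∘unrotate w m ¬odd-x
    ; from∘to = λ {v} _ → unrotate∘rotate v
    ; to∘from = λ {w} ((m , ¬odd-x) , odd-z) → rotate∘unrotate′ w m ¬odd-x odd-z
    }
    where
    T⇒M∘rotate : ∀ v → T v → M (rotate v)
    T⇒M∘rotate v t = trans (Q-sq-rotate v) (T⇒M∘lift v t)
    OddSum⇒∁OddX∘rotate : ∀ v → OddSum v → ¬ OddX (rotate v)
    OddSum⇒∁OddX∘rotate (x , y , _) odd-sum =
      even⇒¬odd (subst Even (sym (regroup x y)) (odd+odd⇒even odd-sum (- (y * + 2) , refl)))
      where
      regroup : ∀ x y → x - + 3 * y + + 1 ≡ x + y + (+ 1 + - (y * + 2) * + 2)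
      regroup = solve-∀
    rotate∘unrotate′ : ∀ w → M w → ¬ OddX w → OddZ w → rotate (unrotate w) ≡ w
    rotate∘unrotate′ (x , y , z) m ¬odd-x odd-z =
      let even-x = ¬odd⇒even ¬odd-x
          k , eq = M∩EvenX∩EvenY∩OddZ⇒4∣y-x+2 even-x (M∩EvenX⇒EvenY x y z m even-x) odd-z m
      in rotate∘unrotate k eq odd-z
    M⇒T∘unrotate : ∀ w → M w → ¬ OddX w → OddZ w → T (unrotate w)
    M⇒T∘unrotate w m ¬odd-x odd-z = M∘lift⇒T (unrotate w)
      (trans (sym (Q-sq-rotate (unrotate w))) (subst M (sym (rotate∘unrotate′ w m ¬odd-x odd-z)) m))
    M⇒OddSum∘unrotate : ∀ w → M w → ¬ OddX w → OddSum (unrotate w)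
    M⇒OddSum∘unrotate (x , y , z) m ¬odd-x = subst Odd (sym (regroup y ((y - x + + 2) / + 4)))
      (even+odd⇒odd (M∩EvenX⇒EvenY x y z m (¬odd⇒even ¬odd-x)) (+ 0 , refl))
      where
      regroup : ∀ y k → y + + 1 - k + k ≡ y + (+ 1 + + 0 * + 2)
      regroup = solve-∀

  halve double : ℤ³ → ℤ³
  halve (x , y , z) = x / + 2 , y / + 2 , z / + 2
  double (x , y , z) = x * + 2 , y * + 2 , z * + 2

  Q-sq-double : ∀ v → Q sq (double v) ≡ Q sq v * + 4
  Q-sq-double (x , y , z) = identity α μ x y z
    where
    identity : ∀ α μ x y z →
      (+ 1 + α * + 2) * ((x * + 2) * (x * + 2)) + + 3 * (+ 1 + α * + 2) * ((y * + 2) * (y * + 2))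
        + (+ 4 + μ * + 8) * ((z * + 2) * (z * + 2))
      ≡ ((+ 1 + α * + 2) * (x * x) + + 3 * (+ 1 + α * + 2) * (y * y) + (+ 4 + μ * + 8) * (z * z)) * + 4
    identity = solve-∀

  M∩∁OddX∩∁OddZ↔K : Correspondence ((M ∩ ∁ OddX) ∩ ∁ OddZ) K
  M∩∁OddX∩∁OddZ↔K = record
    { to      = halve
    ; from    = double
    ; to-⊆    = λ {w} → M⇒K∘halve w
    ; from-⊆  = λ {v} k → (K⇒M∘double v k , even⇒¬odd (proj₁ v , refl)) , even⇒¬odd (proj₂ (proj₂ v) , refl)
    ; from∘to = λ {w} → double∘halve w
    ; to∘from = λ {v} _ → halve∘double v
    }
    where
    regroup : ∀ L → L * + 8 ≡ L * + 2 * + 4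
    regroup = solve-∀
    double∘halve : ∀ w → ((M ∩ ∁ OddX) ∩ ∁ OddZ) w → double (halve w) ≡ w
    double∘halve (x , y , z) ((m , ¬odd-x) , ¬odd-z) =
      cong-ℤ³ ([x/2]*2≡x even-x) ([x/2]*2≡x (M∩EvenX⇒EvenY x y z m even-x)) ([x/2]*2≡x (¬odd⇒even ¬odd-z))
      where
      even-x = ¬odd⇒even ¬odd-x
    halve∘double : ∀ v → halve (double v) ≡ v
    halve∘double (x , y , z) = cong-ℤ³ ([k*d]/d≡k x 2) ([k*d]/d≡k y 2) ([k*d]/d≡k z 2)
    M⇒K∘halve : ∀ w → ((M ∩ ∁ OddX) ∩ ∁ OddZ) w → K (halve w)
    M⇒K∘halve w p = ℤ.*-cancelʳ-≡ _ _ (+ 4) (begin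
      Q sq (halve w) * + 4      ≡⟨ Q-sq-double (halve w) ⟨
      Q sq (double (halve w))   ≡⟨ cong (Q sq) (double∘halve w p) ⟩
      Q sq w                    ≡⟨ proj₁ (proj₁ p) ⟩
      L * + 8                   ≡⟨ regroup L ⟩
      L * + 2 * + 4             ∎)
      where open ≡-Reasoning
    K⇒M∘double : ∀ v → K v → M (double v)
    K⇒M∘double v k = trans (Q-sq-double v) (trans (cong (_* + 4) k) (sym (regroup L)))

module Counting (a m n : ℕ.ℕ) (a-odd : a ℕ.% 2 ≡ 1) where

  open import Data.Integer as ℤ using (+_; _-_; _≟_) renaming (_*_ to _*ℤ_)
  import Data.Integer.Properties as ℤ
  import Data.Integer.Tactic.RingSolver as ℤ-Solver
  open import Data.List using (List; []; _∷_; length; filter)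
  open import Data.List.Membership.Propositional using (_∈_)
  open import Data.Nat using (ℕ; suc; _+_; _*_; _%_; _/_; _≤_; z≤n; s≤s)
  import Data.Nat.Properties as ℕ
  open import Data.Nat.DivMod using (m≡m%n+[m/n]*n)
  open import Data.Nat.Tactic.RingSolver using (solve-∀)
  open import Data.Product using (_,_; proj₁)
  open import Function using (_∘_)
  open import Relation.Binary.PropositionalEquality
  open import Relation.Unary using (_⊆_)
  open import Relation.Unary.Properties using (_∩?_; ∁?)
  open FilterCounting
  open IntegerParity
  open TernaryBoxes

  α : ℕ
  α = a / 2

  open QuadraticForm (+ α) (+ m) (+ n)

  a≡1+α*2 : a ≡ suc (α * 2)
  a≡1+α*2 = trans (m≡m%n+[m/n]*n a 2) (cong (_+ α * 2) a-odd)

  coefficients : List ℕ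
  coefficients = a ∷ 3 * a ∷ 8 * m + 4 ∷ []

  coefficients-in-ℤ : (+ a , + (3 * a) , + (8 * m + 4)) ≡ (A , + 3 *ℤ A , B)
  coefficients-in-ℤ = cong-ℤ³ +a≡A (trans (ℤ.pos-* 3 a) (cong (+ 3 *ℤ_) +a≡A)) +c≡B
    where
    +a≡A : + a ≡ A
    +a≡A = trans (cong +_ a≡1+α*2) (cong (ℤ._+_ (+ 1)) (ℤ.pos-* α 2))
    +c≡B : + (8 * m + 4) ≡ B
    +c≡B = trans (cong +_ (ℕ.+-comm (8 * m) 4))
                 (cong (ℤ._+_ (+ 4)) (trans (cong +_ (ℕ.*-comm 8 m)) (ℤ.pos-* m 8)))

  -- L reduces to + ℓ.
  ℓ 8L 2L : ℕ
  ℓ  = n + (α + m + 1)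
  8L = 8 * n + 4 * a + 8 * m + 4
  2L = 2 * n + a + 2 * m + 1

  L*8≡8L : L *ℤ + 8 ≡ + 8L
  L*8≡8L = trans (sym (ℤ.pos-* ℓ 8))
    (cong +_ (trans (expand n α m) (cong (λ a → 8 * n + 4 * a + 8 * m + 4) (sym a≡1+α*2))))
    where
    expand : ∀ n α m → (n + (α + m + 1)) * 8 ≡ 8 * n + 4 * suc (α * 2) + 8 * m + 4
    expand = solve-∀

  L*2≡2L : L *ℤ + 2 ≡ + 2L
  L*2≡2L = trans (sym (ℤ.pos-* ℓ 2))
    (cong +_ (trans (expand n α m) (cong (λ a → 2 * n + a + 2 * m + 1) (sym a≡1+α*2))))
    where
    expand : ∀ n α m → (n + (α + m + 1)) * 2 ≡ 2 * n + suc (α * 2) + 2 * m + 1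
    expand = solve-∀

  L-odd : n % 2 ≡ (α + m) % 2 → Odd L
  L-odd same = + q , trans (cong +_ ℓ≡1+q*2) (cong (ℤ._+_ (+ 1)) (ℤ.pos-* q 2))
    where
    q = n % 2 + n / 2 + (α + m) / 2
    regroup : ∀ r x y → r + x * 2 + (r + y * 2 + 1) ≡ 1 + (r + x + y) * 2
    regroup = solve-∀
    ℓ≡1+q*2 : ℓ ≡ 1 + q * 2
    ℓ≡1+q*2 = trans (cong₂ (λ x y → x + (y + 1)) (m≡m%n+[m/n]*n n 2)
                      (trans (m≡m%n+[m/n]*n (α + m) 2) (cong (_+ (α + m) / 2 * 2) (sym same))))
                    (regroup (n % 2) (n / 2) ((α + m) / 2))

  solution-in-box : ∀ {d f} → Coercive d f → ∀ {R v} → Q f v ≡ + R → v ∈ box (d + R)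
  solution-in-box {f = f} coercive {v = v} eq =
    solutions-in-box coercive {a} {3 * a} {8 * m + 4} 1≤a (ℕ.≤-trans 1≤a (ℕ.m≤m+n a _))
      (ℕ.≤-trans (s≤s z≤n) (ℕ.m≤n+m 4 (8 * m))) (trans (cong (λ cs → form f cs v) coefficients-in-ℤ) eq)
    where
    1≤a : 1 ≤ a
    1≤a = subst (1 ≤_) (sym a≡1+α*2) (s≤s z≤n)

  T⊆box : T ⊆ (_∈ box (suc n))
  T⊆box t = solution-in-box tri-coercive t

  M⊆box : M ⊆ (_∈ box 8L)
  M⊆box m = solution-in-box sq-coercive (trans m L*8≡8L)

  K⊆box : K ⊆ (_∈ box 2L)
  K⊆box k = solution-in-box sq-coercive (trans k L*2≡2L)

  #T #T∩OddSum #M #K : ℕ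
  #T        = length (filter T? (box (suc n)))
  #T∩OddSum = length (filter (T? ∩? oddSum?) (box (suc n)))
  #M        = length (filter M? (box 8L))
  #K        = length (filter K? (box 2L))

  #T≡2*#T∩OddSum : #T ≡ #T∩OddSum + #T∩OddSum
  #T≡2*#T∩OddSum = trans (length-filter-split T? oddSum? (box (suc n))) (cong (_+_ #T∩OddSum)
    (length-filter-box-correspondence (T? ∩? ∁? oddSum?) (T? ∩? oddSum?) (suc n) (suc n)
      (T⊆box ∘ proj₁) (T⊆box ∘ proj₁) T∩∁OddSum↔T∩OddSum))

  #M≡#T+#T∩OddSum+#K : #M ≡ #T + (#T∩OddSum + #K)
  #M≡#T+#T∩OddSum+#K = begin
    #M
      ≡⟨ length-filter-split M? oddX? (box 8L) ⟩
    length (filter (M? ∩? oddX?) (box 8L)) + length (filter (M? ∩? ∁? oddX?) (box 8L))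
      ≡⟨ cong₂ _+_ (sym (length-filter-box-correspondence T? (M? ∩? oddX?) (suc n) 8L
                           T⊆box (M⊆box ∘ proj₁) T↔M∩OddX))
                   (length-filter-split (M? ∩? ∁? oddX?) oddZ? (box 8L)) ⟩
    #T + (length (filter ((M? ∩? ∁? oddX?) ∩? oddZ?) (box 8L))
          + length (filter ((M? ∩? ∁? oddX?) ∩? ∁? oddZ?) (box 8L)))
      ≡⟨ cong (_+_ #T) (cong₂ _+_
           (sym (length-filter-box-correspondence (T? ∩? oddSum?) ((M? ∩? ∁? oddX?) ∩? oddZ?) (suc n) 8L
                  (T⊆box ∘ proj₁) (M⊆box ∘ proj₁ ∘ proj₁) T∩OddSum↔M∩∁OddX∩OddZ))
           (length-filter-box-correspondence ((M? ∩? ∁? oddX?) ∩? ∁? oddZ?) K? 8L 2L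
              (M⊆box ∘ proj₁ ∘ proj₁) K⊆box M∩∁OddX∩∁OddZ↔K)) ⟩
    #T + (#T∩OddSum + #K) ∎
    where open ≡-Reasoning

  t≡2*#T∩OddSum : t coefficients n ≡ #T∩OddSum + #T∩OddSum
  t≡2*#T∩OddSum = trans (reps-ternary tri (suc n) a (3 * a) (8 * m + 4) (+ n))
    (trans (cong (λ cs → length (filter (λ v → form tri cs v ≟ + n) (box (suc n)))) coefficients-in-ℤ)
           #T≡2*#T∩OddSum)

  N[2L]≡#K : N coefficients 2L ≡ #K
  N[2L]≡#K = trans (reps-ternary sq 2L a (3 * a) (8 * m + 4) (+ 2L))
    (cong₂ (λ cs r → length (filter (λ v → form sq cs v ≟ r) (box 2L))) coefficients-in-ℤ (sym L*2≡2L))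

  N[8L]≡3*#T∩OddSum+N[2L] : N coefficients 8L ≡ #T∩OddSum + #T∩OddSum + (#T∩OddSum + N coefficients 2L)
  N[8L]≡3*#T∩OddSum+N[2L] = begin
    N coefficients 8L
      ≡⟨ reps-ternary sq 8L a (3 * a) (8 * m + 4) (+ 8L) ⟩
    length (filter (λ v → form sq (+ a , + (3 * a) , + (8 * m + 4)) v ≟ + 8L) (box 8L))
      ≡⟨ cong₂ (λ cs r → length (filter (λ v → form sq cs v ≟ r) (box 8L))) coefficients-in-ℤ (sym L*8≡8L) ⟩
    #M
      ≡⟨ #M≡#T+#T∩OddSum+#K ⟩
    #T + (#T∩OddSum + #K)
      ≡⟨ cong₂ (λ t k → t + (#T∩OddSum + k)) (sym #T≡2*#T∩OddSum) N[2L]≡#K ⟨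
    #T∩OddSum + #T∩OddSum + (#T∩OddSum + N coefficients 2L) ∎
    where open ≡-Reasoning

  N[2L]≡0 : n % 2 ≡ (α + m) % 2 → N coefficients 2L ≡ 0
  N[2L]≡0 same = trans N[2L]≡#K (length-filter-empty K? (box 2L) (K-empty (L-odd same)))

  3t≡2N[8L] : n % 2 ≡ (α + m) % 2 → 3 * t coefficients n ≡ 2 * N coefficients 8L
  3t≡2N[8L] same = begin
    3 * t coefficients n     ≡⟨ cong (3 *_) t≡2*#T∩OddSum ⟩
    3 * (p + p)              ≡⟨ identity p ⟩
    2 * (p + p + (p + 0))    ≡⟨ cong (λ k → 2 * (p + p + (p + k))) (N[2L]≡0 same) ⟨
    2 * (p + p + (p + N coefficients 2L))  ≡⟨ cong (2 *_) N[8L]≡3*#T∩OddSum+N[2L] ⟨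
    2 * N coefficients 8L    ∎
    where
    open ≡-Reasoning
    p = #T∩OddSum
    identity : ∀ p → 3 * (p + p) ≡ 2 * (p + p + (p + 0))
    identity = solve-∀

  3t≡2[N[8L]-N[2L]] : + 3 *ℤ + t coefficients n ≡ + 2 *ℤ (+ N coefficients 8L - + N coefficients 2L)
  3t≡2[N[8L]-N[2L]] = begin
    + 3 *ℤ + t coefficients n                   ≡⟨ cong (λ t → + 3 *ℤ + t) t≡2*#T∩OddSum ⟩
    + 3 *ℤ + (p + p)                            ≡⟨ identity (+ p) (+ k) ⟩
    + 2 *ℤ (+ (p + p + (p + k)) - + k)          ≡⟨ cong (λ M → + 2 *ℤ (+ M - + k)) N[8L]≡3*#T∩OddSum+N[2L] ⟨
    + 2 *ℤ (+ N coefficients 8L - + k)          ∎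
    where
    open ≡-Reasoning
    p = #T∩OddSum
    k = N coefficients 2L
    identity : ∀ p k → + 3 *ℤ (p ℤ.+ p) ≡ + 2 *ℤ (p ℤ.+ p ℤ.+ (p ℤ.+ k) - k)
    identity = ℤ-Solver.solve-∀

open import Data.Nat using (ℕ; suc; _+_; _*_; _%_; _/_)
open import Data.Integer using (+_; _-_) renaming (_*_ to _*ℤ_)
open import Data.List using (_∷_; [])
open import Relation.Binary.PropositionalEquality using (_≡_; _≢_)
open import Data.Product using (_×_)
open import Data.Product using (_,_)

-- 1 ≤ a follows from oddness; both identities hold for n = 0, the second one for either parity.
theorem3p3 : (a m : ℕ) → a % 2 ≡ 1 → 1 Data.Nat.≤ a → (n : ℕ) → 1 Data.Nat.≤ n →
    ((n % 2 ≡ ((a / 2) + m) % 2 →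
        3 * t (a ∷ 3 * a ∷ 8 * m + 4 ∷ []) n
          ≡ 2 * N (a ∷ 3 * a ∷ 8 * m + 4 ∷ []) (8 * n + 4 * a + 8 * m + 4))
    × (n % 2 ≢ ((a / 2) + m) % 2 →
        + 3 *ℤ + t (a ∷ 3 * a ∷ 8 * m + 4 ∷ []) n
          ≡ + 2 *ℤ (+ N (a ∷ 3 * a ∷ 8 * m + 4 ∷ []) (8 * n + 4 * a + 8 * m + 4)
                     - + N (a ∷ 3 * a ∷ 8 * m + 4 ∷ []) (2 * n + a + 2 * m + 1))))
theorem3p3 a m a-odd _ n _ = 3t≡2N[8L] , λ _ → 3t≡2[N[8L]-N[2L]]
  where open Counting a m n a-odd
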